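{- Let $H$ be a simple graph with vertices $v_1,\dots,v_k$ and let $G=P_k[\overline{K_{n_1}},\dots,\overline{K_{n_k}}]$ where $P_k$ is the path on $k$ vertices and $k$ is even. Let $A$ be an abelian group with $|A|>2$. Then $0\in spec(G,A)$ if and only if $n_j>1$ for every $j=1,2,\dots,k$.
   Context: For a graph $H$ on vertices $v_1,\dots,v_k$ (in path order for $P_k$) and graphs $G_1,\dots,G_k$, the $H$-join $H[G_1,\dots,G_k]$ is obtained by replacing each $v_i$ by $G_i$ and joining every vertex of $G_i$ to every vertex of $G_j$ whenever $v_iv_j\in E(H)$. $\overline{K_n}$ is the edgeless graph on $n$ vertices. For an additive abelian group $A$ with identity $0$, an $A$-vertex magic labeling of $G$ is a map $l:V(G)\to A\setminus\{0\}$ with $\sum_{u\in N_G(v)} l(u)=\mu$ for all $v$, for some fixed $\mu\in A$ (the magic constant); $spec(G,A)$ is the set of all such magic constants. -}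

module Defs where

open import Level using (Level; _⊔_)
open import Data.Nat using (ℕ; zero; suc; _≡ᵇ_)
open import Data.Fin using (Fin; toℕ)
import Data.Fin as Fin
open import Data.Bool using (Bool; true; false; if_then_else_; _∨_)
open import Data.Product using (Σ; ∃; _×_; _,_)
open import Relation.Nullary using (¬_)
open import Algebra.Bundles using (AbelianGroup)

pathAdj : (k : ℕ) → Fin k → Fin k → Bool
pathAdj k i j = (suc (toℕ i) ≡ᵇ toℕ j) ∨ (suc (toℕ j) ≡ᵇ toℕ i)

-- Vertex set of the H-join H[ K̄_{n_1}, …, K̄_{n_k} ]: pairs (i , a) with a a
-- vertex of the edgeless graph K̄_{n_i}.
JoinVertex : (k : ℕ) → (Fin k → ℕ) → Set
JoinVertex k n = Σ (Fin k) (λ i → Fin (n i))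

module _ {c ℓ : Level} (A : AbelianGroup c ℓ) where
  open AbelianGroup A

  ∑ : (m : ℕ) → (Fin m → Carrier) → Carrier
  ∑ zero    f = ε
  ∑ (suc m) f = f Fin.zero ∙ ∑ m (λ i → f (Fin.suc i))

  -- Inside a
  -- block K̄_{n_i} there are no edges; (i,a) ~ (j,b) iff v_i v_j ∈ E(H).
  joinNbrSum : (k : ℕ) (hAdj : Fin k → Fin k → Bool) (n : Fin k → ℕ) →
               (JoinVertex k n → Carrier) → JoinVertex k n → Carrier
  joinNbrSum k hAdj n l (i , a) =
    ∑ k (λ j → if hAdj i j then ∑ (n j) (λ b → l (j , b)) else ε)

  IsJoinVertexMagic : (k : ℕ) (hAdj : Fin k → Fin k → Bool) (n : Fin k → ℕ) →
                      (JoinVertex k n → Carrier) → Carrier → Set ℓ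
  IsJoinVertexMagic k hAdj n l μ =
    (∀ v → ¬ (l v ≈ ε)) × (∀ v → joinNbrSum k hAdj n l v ≈ μ)

  InJoinSpec : (k : ℕ) (hAdj : Fin k → Fin k → Bool) (n : Fin k → ℕ) →
               Carrier → Set (c ⊔ ℓ)
  InJoinSpec k hAdj n μ =
    ∃ λ (l : JoinVertex k n → Carrier) → IsJoinVertexMagic k hAdj n l μ

  MoreThanTwo : Set (c ⊔ ℓ)
  MoreThanTwo = ∃ λ x → ∃ λ y → ∃ λ z →
    ¬ (x ≈ y) × ¬ (x ≈ z) × ¬ (y ≈ z)

{-# OPTIONS --safe #-}
-- Let S_j be the sum of the labels on the j-th block.  Blocks are independent
-- sets, so the neighbourhood sum of every vertex of block i is S_{i-1} + S_{i+1}
-- (with S_0 = S_{k+1} = 0), and magic constant 0 says S_{i+1} = - S_{i-1}.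
-- Starting from S_0 = 0 this kills every even-indexed block sum and, because
-- k is even, starting from S_{k+1} = 0 it kills every odd-indexed one.  A block
-- with a single vertex would then carry the label 0.  Conversely, with three
-- distinct elements x, y, z every block of size at least 2 can be labelled by
-- nonzero differences with sum 0: pairs x - y, y - x and one triple
-- x - y, y - z, z - x; then every neighbourhood sum is 0.
module Submission where

open import Defs
open import Level using (Level)
open import Data.Nat using (ℕ; zero; suc; _≡ᵇ_; _*_; _+_; _∸_; _<_; _≤_; z≤n; s≤s; z<s)
open import Data.Nat.Properties using (m∸n+n≡m; +-suc; m<n+m; <⇒≤; *-cancelʳ-<; *-cancelʳ-≤; *-monoˡ-<; *-monoˡ-≤)
open import Data.Nat.Divisibility using (_∣_; divides)
open import Data.Fin using (Fin; zero; suc; toℕ; fromℕ<)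
open import Data.Fin.Properties using (toℕ<n; toℕ-fromℕ<)
open import Data.Vec.Functional using (Vector; []; _∷_)
open import Data.Bool using (true; false; T; if_then_else_; _∨_)
open import Data.Product using (∃-syntax; _,_)
open import Data.Sum using (_⊎_; inj₁; inj₂)
open import Data.Empty using (⊥-elim)
open import Function using (_∘_)
open import Function.Bundles using (_⇔_; mk⇔)
open import Relation.Nullary using (¬_)
open import Relation.Binary.PropositionalEquality as ≡ using (_≡_; refl)
open import Algebra.Bundles using (AbelianGroup)
import Algebra.Properties.AbelianGroup as AbelianGroupProperties
import Algebra.Properties.CommutativeMonoid.Sum as CommutativeMonoidSum
import Relation.Binary.Reasoning.Setoid as SetoidReasoning

≡ᵇ-sym : ∀ m n → (m ≡ᵇ n) ≡ (n ≡ᵇ m)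
≡ᵇ-sym zero    zero    = refl
≡ᵇ-sym zero    (suc n) = refl
≡ᵇ-sym (suc m) zero    = refl
≡ᵇ-sym (suc m) (suc n) = ≡ᵇ-sym m n

suc-≡ᵇ-asym : ∀ m n → T (suc m ≡ᵇ n) → ¬ T (suc n ≡ᵇ m)
suc-≡ᵇ-asym zero    (suc n) _ ()
suc-≡ᵇ-asym (suc m) (suc n)   = suc-≡ᵇ-asym m n

even-or-odd : ∀ m → ∃[ s ] (m ≡ s * 2 ⊎ m ≡ suc (s * 2))
even-or-odd zero = 0 , inj₁ refl
even-or-odd (suc m) with even-or-odd m
... | s , inj₁ refl = s , inj₂ refl
... | s , inj₂ refl = suc s , inj₁ refl

module _ {c ℓ : Level} (A : AbelianGroup c ℓ) where
  open AbelianGroup A renaming (refl to ≈-refl)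
  open AbelianGroupProperties A using (identityˡ-unique; identityʳ-unique; x∙y⁻¹≈ε⇒x≈y; \\-leftDividesʳ)
  open CommutativeMonoidSum commutativeMonoid using (sum; sum-cong-≋; sum-replicate-zero; ∑-distrib-+)
  open SetoidReasoning setoid

  ∑≡sum : ∀ m (f : Fin m → Carrier) → ∑ A m f ≡ sum f
  ∑≡sum zero    f = refl
  ∑≡sum (suc m) f = ≡.cong (f zero ∙_) (∑≡sum m (f ∘ suc))

  sum-≈ε : ∀ m {f : Vector Carrier m} → (∀ i → f i ≈ ε) → sum f ≈ ε
  sum-≈ε m f≈ε = trans (sum-cong-≋ f≈ε) (sum-replicate-zero m)

  if-∨-split : ∀ b₁ b₂ x → (T b₁ → ¬ T b₂) →
               (if b₁ ∨ b₂ then x else ε) ≈ (if b₁ then x else ε) ∙ (if b₂ then x else ε)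
  if-∨-split true  true  x disjoint = ⊥-elim (disjoint _ _)
  if-∨-split true  false x _        = sym (identityʳ x)
  if-∨-split false true  x _        = sym (identityˡ x)
  if-∨-split false false x _        = sym (identityˡ ε)

  extendByε : (k : ℕ) → (Fin k → Carrier) → ℕ → Carrier
  extendByε zero    f t       = ε
  extendByε (suc k) f zero    = f zero
  extendByε (suc k) f (suc t) = extendByε k (f ∘ suc) t

  extendByε-toℕ : ∀ {k} (f : Fin k → Carrier) j → extendByε k f (toℕ j) ≡ f j
  extendByε-toℕ f zero    = refl
  extendByε-toℕ f (suc j) = extendByε-toℕ (f ∘ suc) j

  extendByε-length : ∀ k (f : Fin k → Carrier) → extendByε k f k ≡ ε
  extendByε-length zero    f = refl
  extendByε-length (suc k) f = extendByε-length k (f ∘ suc)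

  -- Block j of the path sits at position toℕ j + 1, with zeros at positions
  -- 0 and k + 1 as in the paper's S_0 = S_{k+1} = 0.
  withBoundary : (k : ℕ) → (Fin k → Carrier) → ℕ → Carrier
  withBoundary k f zero    = ε
  withBoundary k f (suc t) = extendByε k f t

  sum-sift : ∀ k (f : Fin k → Carrier) t →
             sum (λ j → if t ≡ᵇ toℕ j then f j else ε) ≈ extendByε k f t
  sum-sift zero    f t       = ≈-refl
  sum-sift (suc k) f zero    = trans (∙-congˡ (sum-≈ε k (λ _ → ≈-refl))) (identityʳ (f zero))
  sum-sift (suc k) f (suc t) = trans (identityˡ _) (sum-sift k (f ∘ suc) t)

  sum-sift-pred : ∀ k (f : Fin k → Carrier) t →
                  sum (λ j → if suc (toℕ j) ≡ᵇ t then f j else ε) ≈ withBoundary k f t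
  sum-sift-pred k f zero    = sum-≈ε k (λ _ → ≈-refl)
  sum-sift-pred k f (suc t) = trans (sum-cong-≋ flip-test) (sum-sift k f t)
    where
    flip-test : ∀ j → (if toℕ j ≡ᵇ t then f j else ε) ≈ (if t ≡ᵇ toℕ j then f j else ε)
    flip-test j = reflexive (≡.cong (if_then f j else ε) (≡ᵇ-sym (toℕ j) t))

  path-neighbourSum : ∀ k (S : Fin k → Carrier) i →
    ∑ A k (λ j → if pathAdj k i j then S j else ε) ≈
    withBoundary k S (2 + toℕ i) ∙ withBoundary k S (toℕ i)
  path-neighbourSum k S i = begin
    ∑ A k (λ j → if pathAdj k i j then S j else ε)  ≡⟨ ∑≡sum k _ ⟩
    sum (λ j → if pathAdj k i j then S j else ε)    ≈⟨ sum-cong-≋ split ⟩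
    sum (λ j → next j ∙ previous j)                  ≈⟨ ∑-distrib-+ next previous ⟩
    sum next ∙ sum previous
      ≈⟨ ∙-cong (sum-sift k S (suc (toℕ i))) (sum-sift-pred k S (toℕ i)) ⟩
    withBoundary k S (2 + toℕ i) ∙ withBoundary k S (toℕ i) ∎
    where
    next previous : Fin k → Carrier
    next     j = if suc (toℕ i) ≡ᵇ toℕ j then S j else ε
    previous j = if suc (toℕ j) ≡ᵇ toℕ i then S j else ε
    split : ∀ j → (if pathAdj k i j then S j else ε) ≈ next j ∙ previous j
    split j = if-∨-split _ _ (S j) (suc-≡ᵇ-asym (toℕ i) (toℕ j))

  module _ (W : ℕ → Carrier) (h : ℕ) (alternating : ∀ s → s < h → W (suc s) ∙ W s ≈ ε) where

    vanishes-from-start : W 0 ≈ ε → ∀ s → s ≤ h → W s ≈ ε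
    vanishes-from-start W₀≈ε zero    _   = W₀≈ε
    vanishes-from-start W₀≈ε (suc s) s<h =
      identityˡ-unique (W (suc s)) (W s)
        (trans (alternating s s<h) (sym (vanishes-from-start W₀≈ε s (<⇒≤ s<h))))

    vanishes-from-end : W h ≈ ε → ∀ s → s ≤ h → W s ≈ ε
    vanishes-from-end Wₕ≈ε s s≤h = downwards (h ∸ s) (m∸n+n≡m s≤h)
      where
      downwards : ∀ u {s} → u + s ≡ h → W s ≈ ε
      downwards zero    u+s≡h = trans (reflexive (≡.cong W u+s≡h)) Wₕ≈ε
      downwards (suc u) {s} u+s≡h =
        identityʳ-unique (W (suc s)) (W s)
          (trans (alternating s s<h) (sym (downwards u (≡.trans (+-suc u s) u+s≡h))))
        where
        s<h : s < h
        s<h = ≡.subst (s <_) u+s≡h (m<n+m s z<s)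

  evenPath-kernel-trivial : ∀ h (S : Fin (h * 2) → Carrier) →
    (∀ i → ∑ A (h * 2) (λ j → if pathAdj (h * 2) i j then S j else ε) ≈ ε) →
    ∀ j → S j ≈ ε
  evenPath-kernel-trivial h S kernel j =
    trans (reflexive (≡.sym (extendByε-toℕ S j))) (interior (toℕ j) (toℕ<n j))
    where
    B : ℕ → Carrier
    B = withBoundary (h * 2) S

    alternating : ∀ t → t < h * 2 → B (2 + t) ∙ B t ≈ ε
    alternating t t<k = begin
      B (2 + t) ∙ B t          ≡⟨ ≡.cong (λ u → B (2 + u) ∙ B u) (≡.sym (toℕ-fromℕ< t<k)) ⟩
      B (2 + toℕ i) ∙ B (toℕ i) ≈⟨ path-neighbourSum (h * 2) S i ⟨
      _                        ≈⟨ kernel i ⟩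
      ε                        ∎
      where i = fromℕ< t<k

    evens : ∀ s → s ≤ h → B (s * 2) ≈ ε
    evens = vanishes-from-start (λ s → B (s * 2)) h
              (λ s s<h → alternating (s * 2) (*-monoˡ-< 2 s<h)) ≈-refl

    odds : ∀ s → s ≤ h → B (suc (s * 2)) ≈ ε
    odds = vanishes-from-end (λ s → B (suc (s * 2))) h
             (λ s s<h → alternating (suc (s * 2)) (*-monoˡ-≤ 2 s<h))
             (reflexive (extendByε-length (h * 2) S))

    interior : ∀ t → t < h * 2 → B (suc t) ≈ ε
    interior t t<k with even-or-odd t
    ... | s , inj₁ refl = odds s (<⇒≤ (*-cancelʳ-< 2 s h t<k))
    ... | s , inj₂ refl = evens (suc s) (*-cancelʳ-≤ (suc s) h 2 t<k)

  1<length-of-zeroSum : ∀ m (f : Fin m → Carrier) → 1 ≤ m → (∀ b → ¬ f b ≈ ε) →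
                        ∑ A m f ≈ ε → 1 < m
  1<length-of-zeroSum (suc zero)    f _ f≉ε ∑f≈ε =
    ⊥-elim (f≉ε zero (trans (sym (identityʳ (f zero))) ∑f≈ε))
  1<length-of-zeroSum (suc (suc m)) _ _ _   _    = s≤s (s≤s z≤n)

  zeroMagic⇒blocks>1 : ∀ h (n : Fin (h * 2) → ℕ) → (∀ j → 1 ≤ n j) →
    InJoinSpec A (h * 2) (pathAdj (h * 2)) n ε → ∀ j → 1 < n j
  zeroMagic⇒blocks>1 h n n≥1 (l , l≉ε , magic) j =
    1<length-of-zeroSum (n j) (λ b → l (j , b)) (n≥1 j) (λ b → l≉ε (j , b))
      (evenPath-kernel-trivial h blockSum (λ i → magic (i , fromℕ< (n≥1 i))) j)
    where
    blockSum : Fin (h * 2) → Carrier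
    blockSum j = ∑ A (n j) (λ b → l (j , b))

  x≉y⇒x-y≉ε : ∀ {x y} → ¬ x ≈ y → ¬ x - y ≈ ε
  x≉y⇒x-y≉ε x≉y x-y≈ε = x≉y (x∙y⁻¹≈ε⇒x≈y _ _ x-y≈ε)

  [x-y]∙[y-z]≈x-z : ∀ x y z → (x - y) ∙ (y - z) ≈ x - z
  [x-y]∙[y-z]≈x-z x y z = begin
    (x ∙ y ⁻¹) ∙ (y ∙ z ⁻¹)  ≈⟨ assoc x (y ⁻¹) (y ∙ z ⁻¹) ⟩
    x ∙ (y ⁻¹ ∙ (y ∙ z ⁻¹))  ≈⟨ ∙-congˡ (\\-leftDividesʳ y (z ⁻¹)) ⟩
    x ∙ z ⁻¹                ∎

  [x-y]∙[[y-x]∙r]≈r : ∀ x y r → (x - y) ∙ ((y - x) ∙ r) ≈ r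
  [x-y]∙[[y-x]∙r]≈r x y r = begin
    (x - y) ∙ ((y - x) ∙ r)  ≈⟨ assoc (x - y) (y - x) r ⟨
    ((x - y) ∙ (y - x)) ∙ r  ≈⟨ ∙-congʳ (trans ([x-y]∙[y-z]≈x-z x y x) (inverseʳ x)) ⟩
    ε ∙ r                    ≈⟨ identityˡ r ⟩
    r                        ∎

  module _ (x y z : Carrier) where

    -- A single vertex admits no zero-sum labelling; the value at m = 1 is junk.
    zeroSumBlock : (m : ℕ) → Vector Carrier m
    zeroSumBlock 0 = []
    zeroSumBlock 1 = x - y ∷ []
    zeroSumBlock 2 = x - y ∷ y - x ∷ []
    zeroSumBlock 3 = x - y ∷ y - z ∷ z - x ∷ []
    zeroSumBlock (suc (suc m@(suc (suc _)))) = x - y ∷ y - x ∷ zeroSumBlock m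

    zeroSumBlock-nonzero : ¬ x ≈ y → ¬ x ≈ z → ¬ y ≈ z → ∀ m i → ¬ zeroSumBlock m i ≈ ε
    zeroSumBlock-nonzero x≉y x≉z y≉z = nonzero
      where
      nonzero : ∀ m i → ¬ zeroSumBlock m i ≈ ε
      nonzero 1 zero = x≉y⇒x-y≉ε x≉y
      nonzero 2 zero = x≉y⇒x-y≉ε x≉y
      nonzero 2 (suc zero) = x≉y⇒x-y≉ε (x≉y ∘ sym)
      nonzero 3 zero = x≉y⇒x-y≉ε x≉y
      nonzero 3 (suc zero) = x≉y⇒x-y≉ε y≉z
      nonzero 3 (suc (suc zero)) = x≉y⇒x-y≉ε (x≉z ∘ sym)
      nonzero (suc (suc (suc (suc m)))) zero = x≉y⇒x-y≉ε x≉y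
      nonzero (suc (suc (suc (suc m)))) (suc zero) = x≉y⇒x-y≉ε (x≉y ∘ sym)
      nonzero (suc (suc (suc (suc m)))) (suc (suc i)) = nonzero (suc (suc m)) i

    zeroSumBlock-sum : ∀ m → 1 < m → ∑ A m (zeroSumBlock m) ≈ ε
    zeroSumBlock-sum 1 (s≤s ())
    zeroSumBlock-sum 2 _ = [x-y]∙[[y-x]∙r]≈r x y ε
    zeroSumBlock-sum 3 _ = begin
      (x - y) ∙ ((y - z) ∙ ((z - x) ∙ ε))  ≈⟨ assoc (x - y) (y - z) _ ⟨
      ((x - y) ∙ (y - z)) ∙ ((z - x) ∙ ε)  ≈⟨ ∙-congʳ ([x-y]∙[y-z]≈x-z x y z) ⟩
      (x - z) ∙ ((z - x) ∙ ε)              ≈⟨ [x-y]∙[[y-x]∙r]≈r x z ε ⟩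
      ε                                    ∎
    zeroSumBlock-sum (suc (suc m@(suc (suc _)))) _ =
      trans ([x-y]∙[[y-x]∙r]≈r x y _) (zeroSumBlock-sum m (s≤s (s≤s z≤n)))

  zeroBlockSums⇒zeroMagic : ∀ k hAdj n (l : JoinVertex k n → Carrier) →
    (∀ j → ∑ A (n j) (λ b → l (j , b)) ≈ ε) → ∀ v → joinNbrSum A k hAdj n l v ≈ ε
  zeroBlockSums⇒zeroMagic k hAdj n l blockSum≈ε (i , _) =
    trans (reflexive (∑≡sum k _)) (sum-≈ε k (λ j → if-≈ε (hAdj i j) (blockSum≈ε j)))
    where
    if-≈ε : ∀ b {a} → a ≈ ε → (if b then a else ε) ≈ ε
    if-≈ε true  a≈ε = a≈ε
    if-≈ε false _   = ≈-refl

  blocks>1⇒zeroMagic : MoreThanTwo A → ∀ k hAdj (n : Fin k → ℕ) → (∀ j → 1 < n j) →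
    InJoinSpec A k hAdj n ε
  blocks>1⇒zeroMagic (x , y , z , x≉y , x≉z , y≉z) k hAdj n n>1 =
    label ,
    (λ (j , b) → zeroSumBlock-nonzero x y z x≉y x≉z y≉z (n j) b) ,
    zeroBlockSums⇒zeroMagic k hAdj n label (λ j → zeroSumBlock-sum x y z (n j) (n>1 j))
    where
    label : JoinVertex k n → Carrier
    label (j , b) = zeroSumBlock x y z (n j) b

mainTheorem14 : {c ℓ : Level} (A : AbelianGroup c ℓ) (k : ℕ) (n : Fin k → ℕ) →
    0 < k → 2 ∣ k → (∀ j → 1 ≤ n j) → MoreThanTwo A →
    InJoinSpec A k (pathAdj k) n (AbelianGroup.ε A) ⇔ (∀ j → 1 < n j)
mainTheorem14 A k n _ (divides h refl) n≥1 moreThanTwo =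
  mk⇔ (zeroMagic⇒blocks>1 A h n n≥1) (blocks>1⇒zeroMagic A moreThanTwo k (pathAdj k) n)
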